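{- Suppose that $C_v$ is block anti-diagonal for all primes $v\mid p$ of $F$. Then, for all $n\ge1$, we have \[ H_{v,n}(\zeta_{p^n}-1)= \begin{cases} \left( \begin{array}{c|c} 0&\delta_n (B_{v,1}B_{v,2})^{(n-1)/2}B_{v,1}\\ \hline 0&0 \end{array} \right)&\text{if $n$ odd,}\\ \left( \begin{array}{c|c} \delta_n(B_{v,1}B_{v,2})^{n/2}&0\\ \hline 0&0 \end{array} \right) &\text{if $n$ even.} \end{cases} \] Here, the constant $\delta_n$ is given by \[ \delta_n=\begin{cases} \frac{\epsilon_1}{\epsilon_2}\cdot \frac{\epsilon_3}{\epsilon_4}\cdots\frac{\epsilon_{n-2}}{\epsilon_{n-1}}&\text{if $n$ odd,}\\ \frac{\epsilon_1}{\epsilon_2}\cdot \frac{\epsilon_3}{\epsilon_4}\cdots\frac{\epsilon_{n-1}}{\epsilon_{n}}&\text{if $n$ even.} \end{cases} \]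
   Context: Let $p$ be an odd prime, $F$ a number field unramified at $p$, and $A$ a $g$-dimensional abelian variety over $F$ with good supersingular reduction at every prime $v\mid p$ of $F$; let $T$ be the $p$-adic Tate module of $A$ and $f_v=[F_v:\mathbf{Q}_p]$. For $v\mid p$, choose a $\mathbf{Z}_p$-basis $u_1,\ldots,u_{2gf_v}$ of the Dieudonné module $\mathbf{D}_{\mathrm{cris},v}(T)$ with $u_1,\ldots,u_{gf_v}$ a basis of $\mathrm{Fil}^0$; the matrix of Frobenius $\varphi$ is $C_v\begin{pmatrix}I_{gf_v}&0\\0&\frac1pI_{gf_v}\end{pmatrix}$ with $C_v\in\mathrm{GL}_{2gf_v}(\mathbf{Z}_p)$. Set $C_{v,n}=\begin{pmatrix}I_{gf_v}&0\\0&\Phi_{p^n}(1+X)I_{gf_v}\end{pmatrix}C_v^{ -1}$ ($\Phi_{p^n}$ the $p^n$-th cyclotomic polynomial) and $H_{v,n}=C_{v,n}\cdots C_{v,1}$. "$C_v$ block anti-diagonal" means (for a suitable such basis) $C_v=\begin{pmatrix}0&*\\ *&0\end{pmatrix}$ with $gf_v\times gf_v$ blocks over $\mathbf{Z}_p$; then $C_{v,n}=\begin{pmatrix}0&B_{v,1}\\ \Phi_{p^n}(1+X)B_{v,2}&0\end{pmatrix}$ for invertible $gf_v\times gf_v$ matrices $B_{v,1},B_{v,2}$ over $\mathbf{Z}_p$ with $\det(B_{v,1}B_{v,2})=1$. For $n\ge1$, $\zeta_{p^n}$ is a fixed primitive $p^n$-th root of unity and $\epsilon_n=\zeta_{p^n}-1$.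 -}

module Defs where

open import Level using (Level)
open import Relation.Nullary using (yes; no)
open import Data.Nat using (ℕ; zero; suc; _∸_)
import Data.Nat as ℕ
open import Data.Fin using (Fin; splitAt)
import Data.Fin as F
open import Data.Sum using (_⊎_; inj₁; inj₂)
open import Algebra.Bundles using (CommutativeRing)

module Over {c ℓ : Level} (R : CommutativeRing c ℓ) where
  open CommutativeRing R

  infixr 8 _^ᴿ_
  _^ᴿ_ : Carrier → ℕ → Carrier
  x ^ᴿ zero  = 1#
  x ^ᴿ suc n = x * (x ^ᴿ n)

  Σ : (n : ℕ) → (Fin n → Carrier) → Carrier
  Σ zero    f = 0#
  Σ (suc n) f = f F.zero + Σ n (λ i → f (F.suc i))

  Σℕ : ℕ → (ℕ → Carrier) → Carrier
  Σℕ zero    f = 0#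
  Σℕ (suc n) f = Σℕ n f + f n

  Mat : ℕ → Set c
  Mat m = Fin m → Fin m → Carrier

  _≈ᴹ_ : {m : ℕ} → Mat m → Mat m → Set ℓ
  A ≈ᴹ B = ∀ i j → A i j ≈ B i j

  _*ᴹ_ : {m : ℕ} → Mat m → Mat m → Mat m
  _*ᴹ_ {m} A B i j = Σ m (λ l → A i l * B l j)

  _•ᴹ_ : {m : ℕ} → Carrier → Mat m → Mat m
  (a •ᴹ A) i j = a * A i j

  𝟘ᴹ : {m : ℕ} → Mat m
  𝟘ᴹ i j = 0#

  Iᴹ : {m : ℕ} → Mat m
  Iᴹ i j with i F.≟ j
  ... | yes _ = 1#
  ... | no  _ = 0#

  _^ᴹ_ : {m : ℕ} → Mat m → ℕ → Mat m
  A ^ᴹ zero  = Iᴹ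
  A ^ᴹ suc n = A *ᴹ (A ^ᴹ n)

  block : {k : ℕ} → Mat k → Mat k → Mat k → Mat k → Mat (k ℕ.+ k)
  block {k} A B C D i j with splitAt k i | splitAt k j
  ... | inj₁ a | inj₁ b = A a b
  ... | inj₁ a | inj₂ b = B a b
  ... | inj₂ a | inj₁ b = C a b
  ... | inj₂ a | inj₂ b = D a b

  topLeft topRight bottomLeft bottomRight : {k : ℕ} → Mat (k ℕ.+ k) → Mat k
  topLeft     {k} M a b = M (a F.↑ˡ k) (b F.↑ˡ k)
  topRight    {k} M a b = M (a F.↑ˡ k) (k F.↑ʳ b)
  bottomLeft  {k} M a b = M (k F.↑ʳ a) (b F.↑ˡ k)
  bottomRight {k} M a b = M (k F.↑ʳ a) (k F.↑ʳ b)

  -- p^m-th cyclotomic polynomial evaluated at x (m ≥ 1):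
  -- Φ_{p^m}(x) = Σ_{i<p} x^(i p^(m-1))
  Φ : (p m : ℕ) → Carrier → Carrier
  Φ p m x = Σℕ p (λ i → x ^ᴿ (i ℕ.* p ℕ.^ (m ∸ 1)))

  -- C_{v,m}(X) = diag(I, Φ_{p^m}(1+X) I) C_v^{-1}, evaluated at X = z - 1
  -- (so 1 + X = z).
  Cev : (p : ℕ) {k : ℕ} → Mat (k ℕ.+ k) → ℕ → Carrier → Mat (k ℕ.+ k)
  Cev p {k} Cinv m z = block {k} Iᴹ 𝟘ᴹ 𝟘ᴹ (Φ p m z •ᴹ Iᴹ) *ᴹ Cinv

  Hev : (p : ℕ) {k : ℕ} → Mat (k ℕ.+ k) → ℕ → Carrier → Mat (k ℕ.+ k)
  Hev p {k} Cinv zero    z = Iᴹ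
  Hev p {k} Cinv (suc n) z = Cev p {k} Cinv (suc n) z *ᴹ Hev p {k} Cinv n z

  -- δ-pairs: Π_{j=1}^{m} ε_{2j-1} / ε_{2j}, with ε_k = ζ_k - 1, division via inv
  δpairs : (ε : ℕ → Carrier) (inv : Carrier → Carrier) → ℕ → Carrier
  δpairs ε inv zero    = 1#
  δpairs ε inv (suc m) =
    δpairs ε inv m * (ε (1 ℕ.+ 2 ℕ.* m) * inv (ε (2 ℕ.+ 2 ℕ.* m)))

  -- δ_n = (ε₁/ε₂)(ε₃/ε₄)⋯ up to ε_{n-2}/ε_{n-1} (n odd) or ε_{n-1}/ε_n (n even)
  δ : (ε : ℕ → Carrier) (inv : Carrier → Carrier) → ℕ → Carrier
  δ ε inv n = δpairs ε inv (n ℕ./ 2)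

{-# OPTIONS --safe #-}
module Submission where

-- C_v⁻¹ is the inverse of an antidiagonal block matrix, hence itself antidiagonal, so
-- C_{v,m}(ζ_n − 1) = antidiag(B₁, Φ_{p^m}(ζ_n) B₂).  Since ζ_n^{p^{m−1}} = ζ_{n−m+1}, the geometric
-- series gives ε_{n−m+1} Φ_{p^m}(ζ_n) = ε_{n−m}: the value vanishes for m = n and equals
-- ε_{n−m}/ε_{n−m+1} for m < n.  Expanding C_n ⋯ C_1 from the left, C_n has zero bottom row, and each
-- further antidiagonal factor moves the only nonzero block of the top row to the other column,
-- picking up Φ_{p^m}(ζ_n) on every second step only; these are the factors ε_{2j−1}/ε_{2j} of δ_n.

open import Level using (Level)
open import Function.Base using (_∘_)
open import Data.Nat using (ℕ; zero; suc; _≤_; _∸_; _/_; _%_)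
import Data.Nat
import Data.Nat as ℕ
import Data.Nat.Properties as ℕₚ
open import Data.Nat.DivMod using (m≡m%n+[m/n]*n; m*n/n≡m)
open import Data.Nat.Primality using (Prime)
open import Data.Fin using (Fin; splitAt; _↑ˡ_; _↑ʳ_; punchIn)
import Data.Fin as F
open import Data.Fin.Properties
  using (splitAt-↑ˡ; splitAt-↑ʳ; splitAt⁻¹-↑ˡ; splitAt⁻¹-↑ʳ; ↑ˡ-injective; ↑ʳ-injective; punchInᵢ≢i)
open import Data.Sum using (inj₁; inj₂)
open import Data.Product using (_×_; _,_)
open import Relation.Nullary using (¬_; yes; no; contradiction)
open import Relation.Binary.PropositionalEquality as ≡ using (_≡_; _≢_)
open import Relation.Binary.Bundles using (Setoid)
open import Algebra.Bundles using (CommutativeRing)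
open import Defs

n%2≡1⇒n≡1+2*[n/2] : ∀ n → n % 2 ≡ 1 → n ≡ suc (2 ℕ.* (n / 2))
n%2≡1⇒n≡1+2*[n/2] n n%2≡1 = ≡.trans (m≡m%n+[m/n]*n n 2) (≡.cong₂ ℕ._+_ n%2≡1 (ℕₚ.*-comm (n / 2) 2))

n%2≡0⇒n≡2*[n/2] : ∀ n → n % 2 ≡ 0 → n ≡ 2 ℕ.* (n / 2)
n%2≡0⇒n≡2*[n/2] n n%2≡0 = ≡.trans (m≡m%n+[m/n]*n n 2) (≡.cong₂ ℕ._+_ n%2≡0 (ℕₚ.*-comm (n / 2) 2))

n%2≡1⇒[n∸1]/2≡n/2 : ∀ n → n % 2 ≡ 1 → (n ∸ 1) / 2 ≡ n / 2
n%2≡1⇒[n∸1]/2≡n/2 n n%2≡1 = begin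
  (n ∸ 1) / 2            ≡⟨ ≡.cong (λ m → (m ∸ 1) / 2) (n%2≡1⇒n≡1+2*[n/2] n n%2≡1) ⟩
  (2 ℕ.* (n / 2)) / 2    ≡⟨ ≡.cong (_/ 2) (ℕₚ.*-comm 2 (n / 2)) ⟩
  (n / 2 ℕ.* 2) / 2      ≡⟨ m*n/n≡m (n / 2) 2 ⟩
  n / 2                  ∎
  where open ≡.≡-Reasoning

module MatrixAlgebra {c ℓ : Level} (R : CommutativeRing c ℓ) where
  open CommutativeRing R
  open Over R
  open import Algebra.Properties.Semiring.Sum semiring
    using (sum; sum-cong-≋; sum-replicate-zero; sum-remove; ∑-comm; *-distribˡ-sum; *-distribʳ-sum)
  open import Data.Vec.Functional.Relation.Binary.Equality.Setoid using (≋-setoid)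
  open import Algebra.Properties.CommutativeSemigroup *-commutativeSemigroup using (x∙yz≈y∙xz)
  open import Relation.Binary.Reasoning.Setoid setoid

  Σ≈sum : ∀ n (f : Fin n → Carrier) → Σ n f ≈ sum f
  Σ≈sum zero    f = refl
  Σ≈sum (suc n) f = +-congˡ (Σ≈sum n (f ∘ F.suc))

  Σ-cong : ∀ n {f g : Fin n → Carrier} → (∀ i → f i ≈ g i) → Σ n f ≈ Σ n g
  Σ-cong n {f} {g} f≈g = begin
    Σ n f ≈⟨ Σ≈sum n f ⟩
    sum f ≈⟨ sum-cong-≋ f≈g ⟩
    sum g ≈⟨ Σ≈sum n g ⟨
    Σ n g ∎

  Σ-zero : ∀ n {f : Fin n → Carrier} → (∀ i → f i ≈ 0#) → Σ n f ≈ 0#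
  Σ-zero n {f} f≈0 = begin
    Σ n f          ≈⟨ Σ-cong n f≈0 ⟩
    Σ n (λ _ → 0#) ≈⟨ Σ≈sum n _ ⟩
    sum {n} (λ _ → 0#) ≈⟨ sum-replicate-zero n ⟩
    0#             ∎

  Σ-distribˡ : ∀ n a (f : Fin n → Carrier) → a * Σ n f ≈ Σ n (λ i → a * f i)
  Σ-distribˡ n a f = begin
    a * Σ n f               ≈⟨ *-congˡ (Σ≈sum n f) ⟩
    a * sum f               ≈⟨ *-distribˡ-sum a f ⟩
    sum (λ i → a * f i)     ≈⟨ Σ≈sum n _ ⟨
    Σ n (λ i → a * f i)     ∎

  Σ-distribʳ : ∀ n a (f : Fin n → Carrier) → Σ n f * a ≈ Σ n (λ i → f i * a)
  Σ-distribʳ n a f = begin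
    Σ n f * a               ≈⟨ *-congʳ (Σ≈sum n f) ⟩
    sum f * a               ≈⟨ *-distribʳ-sum a f ⟩
    sum (λ i → f i * a)     ≈⟨ Σ≈sum n _ ⟨
    Σ n (λ i → f i * a)     ∎

  Σ-comm : ∀ m n (f : Fin m → Fin n → Carrier) →
           Σ m (λ i → Σ n (f i)) ≈ Σ n (λ j → Σ m (λ i → f i j))
  Σ-comm m n f = begin
    Σ m (λ i → Σ n (f i))               ≈⟨ Σ-cong m (λ i → Σ≈sum n (f i)) ⟩
    Σ m (λ i → sum (f i))               ≈⟨ Σ≈sum m _ ⟩
    sum (λ i → sum (f i))               ≈⟨ ∑-comm f ⟩
    sum (λ j → sum (λ i → f i j))       ≈⟨ Σ≈sum n _ ⟨
    Σ n (λ j → sum (λ i → f i j))       ≈⟨ Σ-cong n (λ j → Σ≈sum m _) ⟨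
    Σ n (λ j → Σ m (λ i → f i j))       ∎

  Σ-single : ∀ {n} (f : Fin n → Carrier) i → (∀ j → j ≢ i → f j ≈ 0#) → Σ n f ≈ f i
  Σ-single {suc n} f i others≈0 = begin
    Σ (suc n) f                ≈⟨ Σ≈sum (suc n) f ⟩
    sum f                      ≈⟨ sum-remove {i = i} f ⟩
    f i + sum (f ∘ punchIn i)  ≈⟨ +-congˡ (sum-cong-≋ (λ j → others≈0 _ (punchInᵢ≢i i j))) ⟩
    f i + sum {n} (λ _ → 0#)   ≈⟨ +-congˡ (sum-replicate-zero n) ⟩
    f i + 0#                   ≈⟨ +-identityʳ (f i) ⟩
    f i                        ∎

  Σ-split : ∀ m n (f : Fin (m ℕ.+ n) → Carrier) →
            Σ (m ℕ.+ n) f ≈ Σ m (λ a → f (a ↑ˡ n)) + Σ n (λ b → f (m ↑ʳ b))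
  Σ-split zero    n f = sym (+-identityˡ _)
  Σ-split (suc m) n f = trans (+-congˡ (Σ-split m n (f ∘ F.suc))) (sym (+-assoc _ _ _))

  ≈ᴹ-setoid : ℕ → Setoid c ℓ
  ≈ᴹ-setoid m = ≋-setoid (≋-setoid setoid m) m

  module ≈ᴹ {m : ℕ} = Setoid (≈ᴹ-setoid m)

  Iᴹ-diagonal : ∀ {m} (i : Fin m) → Iᴹ i i ≈ 1#
  Iᴹ-diagonal i with i F.≟ i
  ... | yes _   = refl
  ... | no  i≢i = contradiction ≡.refl i≢i

  Iᴹ-offDiagonal : ∀ {m} {i j : Fin m} → i ≢ j → Iᴹ i j ≈ 0#
  Iᴹ-offDiagonal {i = i} {j} i≢j with i F.≟ j
  ... | yes i≡j = contradiction i≡j i≢j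
  ... | no  _   = refl

  Iᴹ-injective : ∀ {m n} (g : Fin m → Fin n) → (∀ i j → g i ≡ g j → i ≡ j) →
                 ∀ i j → Iᴹ (g i) (g j) ≈ Iᴹ i j
  Iᴹ-injective g g-injective i j with i F.≟ j
  ... | yes ≡.refl = Iᴹ-diagonal (g i)
  ... | no  i≢j    = Iᴹ-offDiagonal (i≢j ∘ g-injective i j)

  *ᴹ-cong : ∀ {m} {A A′ B B′ : Mat m} → A ≈ᴹ A′ → B ≈ᴹ B′ → (A *ᴹ B) ≈ᴹ (A′ *ᴹ B′)
  *ᴹ-cong {m} A≈A′ B≈B′ i j = Σ-cong m (λ l → *-cong (A≈A′ i l) (B≈B′ l j))

  *ᴹ-assoc : ∀ {m} (A B C : Mat m) → ((A *ᴹ B) *ᴹ C) ≈ᴹ (A *ᴹ (B *ᴹ C))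
  *ᴹ-assoc {m} A B C i j = begin
    Σ m (λ l → Σ m (λ q → A i q * B q l) * C l j)   ≈⟨ Σ-cong m (λ l → Σ-distribʳ m (C l j) _) ⟩
    Σ m (λ l → Σ m (λ q → A i q * B q l * C l j))   ≈⟨ Σ-comm m m _ ⟩
    Σ m (λ q → Σ m (λ l → A i q * B q l * C l j))   ≈⟨ Σ-cong m (λ q → Σ-cong m (λ l → *-assoc _ _ _)) ⟩
    Σ m (λ q → Σ m (λ l → A i q * (B q l * C l j))) ≈⟨ Σ-cong m (λ q → Σ-distribˡ m (A i q) _) ⟨
    Σ m (λ q → A i q * Σ m (λ l → B q l * C l j))   ∎

  *ᴹ-identityˡ : ∀ {m} (A : Mat m) → (Iᴹ *ᴹ A) ≈ᴹ A
  *ᴹ-identityˡ A i j = begin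
    Σ _ (λ l → Iᴹ i l * A l j) ≈⟨ Σ-single _ i (λ l l≢i → trans (*-congʳ (Iᴹ-offDiagonal (l≢i ∘ ≡.sym))) (zeroˡ _)) ⟩
    Iᴹ i i * A i j             ≈⟨ trans (*-congʳ (Iᴹ-diagonal i)) (*-identityˡ _) ⟩
    A i j                      ∎

  *ᴹ-identityʳ : ∀ {m} (A : Mat m) → (A *ᴹ Iᴹ) ≈ᴹ A
  *ᴹ-identityʳ A i j = begin
    Σ _ (λ l → A i l * Iᴹ l j) ≈⟨ Σ-single _ j (λ l l≢j → trans (*-congˡ (Iᴹ-offDiagonal l≢j)) (zeroʳ _)) ⟩
    A i j * Iᴹ j j             ≈⟨ trans (*-congˡ (Iᴹ-diagonal j)) (*-identityʳ _) ⟩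
    A i j                      ∎

  *ᴹ-zeroˡ : ∀ {m} (A : Mat m) → (𝟘ᴹ *ᴹ A) ≈ᴹ 𝟘ᴹ
  *ᴹ-zeroˡ {m} A i j = Σ-zero m (λ l → zeroˡ (A l j))

  *ᴹ-zeroʳ : ∀ {m} (A : Mat m) → (A *ᴹ 𝟘ᴹ) ≈ᴹ 𝟘ᴹ
  *ᴹ-zeroʳ {m} A i j = Σ-zero m (λ l → zeroʳ (A i l))

  ^ᴹ-sucʳ : ∀ {m} (A : Mat m) t → ((A ^ᴹ t) *ᴹ A) ≈ᴹ (A ^ᴹ suc t)
  ^ᴹ-sucʳ A zero    = ≈ᴹ.trans (*ᴹ-identityˡ A) (≈ᴹ.sym (*ᴹ-identityʳ A))
  ^ᴹ-sucʳ A (suc t) = ≈ᴹ.trans (*ᴹ-assoc A (A ^ᴹ t) A) (*ᴹ-cong ≈ᴹ.refl (^ᴹ-sucʳ A t))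

  •ᴹ-cong : ∀ {m} {a b} {A B : Mat m} → a ≈ b → A ≈ᴹ B → (a •ᴹ A) ≈ᴹ (b •ᴹ B)
  •ᴹ-cong a≈b A≈B i j = *-cong a≈b (A≈B i j)

  •ᴹ-*ᴹ : ∀ {m} a (A B : Mat m) → ((a •ᴹ A) *ᴹ B) ≈ᴹ (a •ᴹ (A *ᴹ B))
  •ᴹ-*ᴹ {m} a A B i j = trans (Σ-cong m (λ l → *-assoc _ _ _)) (sym (Σ-distribˡ m a _))

  •ᴹ-*ᴹ-•ᴹ : ∀ {m} a b (A B : Mat m) → ((a •ᴹ A) *ᴹ (b •ᴹ B)) ≈ᴹ ((a * b) •ᴹ (A *ᴹ B))
  •ᴹ-*ᴹ-•ᴹ {m} a b A B i j = begin
    Σ m (λ l → a * A i l * (b * B l j)) ≈⟨ Σ-cong m (λ l → regroup (A i l) (B l j)) ⟩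
    Σ m (λ l → (a * b) * (A i l * B l j)) ≈⟨ Σ-distribˡ m (a * b) _ ⟨
    (a * b) * Σ m (λ l → A i l * B l j) ∎
    where
    regroup : ∀ x y → a * x * (b * y) ≈ (a * b) * (x * y)
    regroup x y = begin
      a * x * (b * y)   ≈⟨ *-assoc a x (b * y) ⟩
      a * (x * (b * y)) ≈⟨ *-congˡ (x∙yz≈y∙xz x b y) ⟩
      a * (b * (x * y)) ≈⟨ *-assoc a b (x * y) ⟨
      (a * b) * (x * y) ∎

  infixl 6 _+ᴹ_
  _+ᴹ_ : ∀ {m} → Mat m → Mat m → Mat m
  (A +ᴹ B) i j = A i j + B i j

  +ᴹ-cong : ∀ {m} {A A′ B B′ : Mat m} → A ≈ᴹ A′ → B ≈ᴹ B′ → (A +ᴹ B) ≈ᴹ (A′ +ᴹ B′)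
  +ᴹ-cong A≈A′ B≈B′ i j = +-cong (A≈A′ i j) (B≈B′ i j)

  +ᴹ-cancel-𝟘ˡ : ∀ {m} {A B : Mat m} → A ≈ᴹ 𝟘ᴹ → (A +ᴹ B) ≈ᴹ B
  +ᴹ-cancel-𝟘ˡ A≈𝟘 i j = trans (+-congʳ (A≈𝟘 i j)) (+-identityˡ _)

  +ᴹ-cancel-𝟘ʳ : ∀ {m} {A B : Mat m} → B ≈ᴹ 𝟘ᴹ → (A +ᴹ B) ≈ᴹ A
  +ᴹ-cancel-𝟘ʳ B≈𝟘 i j = trans (+-congˡ (B≈𝟘 i j)) (+-identityʳ _)

  module _ {k : ℕ} where

    topLeft-block : ∀ (A B C D : Mat k) → topLeft {k} (block A B C D) ≈ᴹ A
    topLeft-block A B C D a b rewrite splitAt-↑ˡ k a k | splitAt-↑ˡ k b k = refl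

    topRight-block : ∀ (A B C D : Mat k) → topRight {k} (block A B C D) ≈ᴹ B
    topRight-block A B C D a b rewrite splitAt-↑ˡ k a k | splitAt-↑ʳ k k b = refl

    bottomLeft-block : ∀ (A B C D : Mat k) → bottomLeft {k} (block A B C D) ≈ᴹ C
    bottomLeft-block A B C D a b rewrite splitAt-↑ʳ k k a | splitAt-↑ˡ k b k = refl

    bottomRight-block : ∀ (A B C D : Mat k) → bottomRight {k} (block A B C D) ≈ᴹ D
    bottomRight-block A B C D a b rewrite splitAt-↑ʳ k k a | splitAt-↑ʳ k k b = refl

    ≈ᴹ-block : ∀ {M : Mat (k ℕ.+ k)} {A B C D : Mat k} →
               topLeft {k} M ≈ᴹ A → topRight {k} M ≈ᴹ B → bottomLeft {k} M ≈ᴹ C → bottomRight {k} M ≈ᴹ D →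
               M ≈ᴹ block A B C D
    ≈ᴹ-block {M} tl tr bl br i j with splitAt k i in i≡ | splitAt k j in j≡
    ... | inj₁ a | inj₁ b = ≡.subst₂ (λ i j → M i j ≈ _) (splitAt⁻¹-↑ˡ i≡) (splitAt⁻¹-↑ˡ j≡) (tl a b)
    ... | inj₁ a | inj₂ b = ≡.subst₂ (λ i j → M i j ≈ _) (splitAt⁻¹-↑ˡ i≡) (splitAt⁻¹-↑ʳ j≡) (tr a b)
    ... | inj₂ a | inj₁ b = ≡.subst₂ (λ i j → M i j ≈ _) (splitAt⁻¹-↑ʳ i≡) (splitAt⁻¹-↑ˡ j≡) (bl a b)
    ... | inj₂ a | inj₂ b = ≡.subst₂ (λ i j → M i j ≈ _) (splitAt⁻¹-↑ʳ i≡) (splitAt⁻¹-↑ʳ j≡) (br a b)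

    block-η : ∀ (M : Mat (k ℕ.+ k)) → M ≈ᴹ block (topLeft {k} M) (topRight {k} M) (bottomLeft {k} M) (bottomRight {k} M)
    block-η M = ≈ᴹ-block ≈ᴹ.refl ≈ᴹ.refl ≈ᴹ.refl ≈ᴹ.refl

    block-cong : ∀ {A A′ B B′ C C′ D D′ : Mat k} →
                 A ≈ᴹ A′ → B ≈ᴹ B′ → C ≈ᴹ C′ → D ≈ᴹ D′ → block A B C D ≈ᴹ block A′ B′ C′ D′
    block-cong {A} {A′} {B} {B′} {C} {C′} {D} {D′} A≈ B≈ C≈ D≈ = ≈ᴹ-block
      (λ a b → trans (topLeft-block A B C D a b) (A≈ a b))
      (λ a b → trans (topRight-block A B C D a b) (B≈ a b))
      (λ a b → trans (bottomLeft-block A B C D a b) (C≈ a b))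
      (λ a b → trans (bottomRight-block A B C D a b) (D≈ a b))

    topLeft-*ᴹ : ∀ (M N : Mat (k ℕ.+ k)) →
      topLeft {k} (M *ᴹ N) ≈ᴹ (topLeft {k} M *ᴹ topLeft {k} N +ᴹ topRight {k} M *ᴹ bottomLeft {k} N)
    topLeft-*ᴹ M N a b = Σ-split k k _

    topRight-*ᴹ : ∀ (M N : Mat (k ℕ.+ k)) →
      topRight {k} (M *ᴹ N) ≈ᴹ (topLeft {k} M *ᴹ topRight {k} N +ᴹ topRight {k} M *ᴹ bottomRight {k} N)
    topRight-*ᴹ M N a b = Σ-split k k _

    bottomLeft-*ᴹ : ∀ (M N : Mat (k ℕ.+ k)) →
      bottomLeft {k} (M *ᴹ N) ≈ᴹ (bottomLeft {k} M *ᴹ topLeft {k} N +ᴹ bottomRight {k} M *ᴹ bottomLeft {k} N)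
    bottomLeft-*ᴹ M N a b = Σ-split k k _

    bottomRight-*ᴹ : ∀ (M N : Mat (k ℕ.+ k)) →
      bottomRight {k} (M *ᴹ N) ≈ᴹ (bottomLeft {k} M *ᴹ topRight {k} N +ᴹ bottomRight {k} M *ᴹ bottomRight {k} N)
    bottomRight-*ᴹ M N a b = Σ-split k k _

    block-*ᴹ-block : ∀ (A B C D E F G H : Mat k) →
      (block A B C D *ᴹ block E F G H) ≈ᴹ
      block (A *ᴹ E +ᴹ B *ᴹ G) (A *ᴹ F +ᴹ B *ᴹ H) (C *ᴹ E +ᴹ D *ᴹ G) (C *ᴹ F +ᴹ D *ᴹ H)
    block-*ᴹ-block A B C D E F G H = ≈ᴹ-block
      (≈ᴹ.trans (topLeft-*ᴹ M N) (+ᴹ-cong (*ᴹ-cong (topLeft-block A B C D) (topLeft-block E F G H))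
                                          (*ᴹ-cong (topRight-block A B C D) (bottomLeft-block E F G H))))
      (≈ᴹ.trans (topRight-*ᴹ M N) (+ᴹ-cong (*ᴹ-cong (topLeft-block A B C D) (topRight-block E F G H))
                                           (*ᴹ-cong (topRight-block A B C D) (bottomRight-block E F G H))))
      (≈ᴹ.trans (bottomLeft-*ᴹ M N) (+ᴹ-cong (*ᴹ-cong (bottomLeft-block A B C D) (topLeft-block E F G H))
                                             (*ᴹ-cong (bottomRight-block A B C D) (bottomLeft-block E F G H))))
      (≈ᴹ.trans (bottomRight-*ᴹ M N) (+ᴹ-cong (*ᴹ-cong (bottomLeft-block A B C D) (topRight-block E F G H))
                                              (*ᴹ-cong (bottomRight-block A B C D) (bottomRight-block E F G H))))
      where
      M N : Mat (k ℕ.+ k)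
      M = block A B C D
      N = block E F G H

    *ᴹ-antidiagonal : ∀ (A B C D E F : Mat k) →
      (block A B C D *ᴹ block 𝟘ᴹ E F 𝟘ᴹ) ≈ᴹ block (B *ᴹ F) (A *ᴹ E) (D *ᴹ F) (C *ᴹ E)
    *ᴹ-antidiagonal A B C D E F = ≈ᴹ.trans (block-*ᴹ-block A B C D 𝟘ᴹ E F 𝟘ᴹ) (block-cong
      (+ᴹ-cancel-𝟘ˡ (*ᴹ-zeroʳ A)) (+ᴹ-cancel-𝟘ʳ (*ᴹ-zeroʳ B))
      (+ᴹ-cancel-𝟘ˡ (*ᴹ-zeroʳ C)) (+ᴹ-cancel-𝟘ʳ (*ᴹ-zeroʳ D)))

    antidiagonal-*ᴹ : ∀ (E F A B C D : Mat k) →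
      (block 𝟘ᴹ E F 𝟘ᴹ *ᴹ block A B C D) ≈ᴹ block (E *ᴹ C) (E *ᴹ D) (F *ᴹ A) (F *ᴹ B)
    antidiagonal-*ᴹ E F A B C D = ≈ᴹ.trans (block-*ᴹ-block 𝟘ᴹ E F 𝟘ᴹ A B C D) (block-cong
      (+ᴹ-cancel-𝟘ˡ (*ᴹ-zeroˡ A)) (+ᴹ-cancel-𝟘ˡ (*ᴹ-zeroˡ B))
      (+ᴹ-cancel-𝟘ʳ (*ᴹ-zeroˡ C)) (+ᴹ-cancel-𝟘ʳ (*ᴹ-zeroˡ D)))

    ↑ˡ≢↑ʳ : ∀ (a b : Fin k) → a ↑ˡ k ≢ k ↑ʳ b
    ↑ˡ≢↑ʳ a b a≡b with ≡.trans (≡.sym (splitAt-↑ˡ k a k)) (≡.trans (≡.cong (splitAt k) a≡b) (splitAt-↑ʳ k k b))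
    ... | ()

    block≈Iᴹ⇒I𝟘𝟘I : ∀ {A B C D : Mat k} → block A B C D ≈ᴹ Iᴹ →
                     (A ≈ᴹ Iᴹ) × (B ≈ᴹ 𝟘ᴹ) × (C ≈ᴹ 𝟘ᴹ) × (D ≈ᴹ Iᴹ)
    block≈Iᴹ⇒I𝟘𝟘I {A} {B} {C} {D} M≈I =
      (λ a b → trans (sym (topLeft-block A B C D a b))
                 (trans (M≈I _ _) (Iᴹ-injective (_↑ˡ k) (↑ˡ-injective k) a b))) ,
      (λ a b → trans (sym (topRight-block A B C D a b))
                 (trans (M≈I _ _) (Iᴹ-offDiagonal (↑ˡ≢↑ʳ a b)))) ,
      (λ a b → trans (sym (bottomLeft-block A B C D a b))
                 (trans (M≈I _ _) (Iᴹ-offDiagonal (↑ˡ≢↑ʳ b a ∘ ≡.sym)))) ,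
      (λ a b → trans (sym (bottomRight-block A B C D a b))
                 (trans (M≈I _ _) (Iᴹ-injective (k ↑ʳ_) (↑ʳ-injective k) a b)))

  Q*A≈𝟘⇒A≈𝟘 : ∀ {m} {B Q A : Mat m} → (B *ᴹ Q) ≈ᴹ Iᴹ → (Q *ᴹ A) ≈ᴹ 𝟘ᴹ → A ≈ᴹ 𝟘ᴹ
  Q*A≈𝟘⇒A≈𝟘 {B = B} {Q} {A} B*Q≈I Q*A≈𝟘 =
    ≈ᴹ.trans (≈ᴹ.sym (*ᴹ-identityˡ A)) (≈ᴹ.trans (*ᴹ-cong (≈ᴹ.sym B*Q≈I) ≈ᴹ.refl)
      (≈ᴹ.trans (*ᴹ-assoc B Q A) (≈ᴹ.trans (*ᴹ-cong ≈ᴹ.refl Q*A≈𝟘) (*ᴹ-zeroʳ B))))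

  antidiagonal-inverse : ∀ {k} {P Q : Mat k} {C : Mat (k ℕ.+ k)} →
    (block 𝟘ᴹ P Q 𝟘ᴹ *ᴹ C) ≈ᴹ Iᴹ → (C *ᴹ block 𝟘ᴹ P Q 𝟘ᴹ) ≈ᴹ Iᴹ →
    C ≈ᴹ block 𝟘ᴹ (topRight {k} C) (bottomLeft {k} C) 𝟘ᴹ
  antidiagonal-inverse {k} {P} {Q} {C} N*C≈I C*N≈I =
    -- the off-diagonal quadrants of N C = I and the diagonal ones of C N = I give
    -- A = (B₁ Q) A = B₁ (Q A) = 𝟘 and D = (B₂ P) D = 𝟘
    let _ , P*D≈𝟘 , Q*A≈𝟘 , _ = block≈Iᴹ⇒I𝟘𝟘I (≈ᴹ.trans (≈ᴹ.sym (antidiagonal-*ᴹ P Q A B₁ B₂ D))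
                                   (≈ᴹ.trans (*ᴹ-cong ≈ᴹ.refl (≈ᴹ.sym (block-η {k} C))) N*C≈I))
        B₁*Q≈I , _ , _ , B₂*P≈I = block≈Iᴹ⇒I𝟘𝟘I (≈ᴹ.trans (≈ᴹ.sym (*ᴹ-antidiagonal A B₁ B₂ D P Q))
                                   (≈ᴹ.trans (*ᴹ-cong (≈ᴹ.sym (block-η {k} C)) ≈ᴹ.refl) C*N≈I))
    in ≈ᴹ.trans (block-η {k} C)
         (block-cong {k} (Q*A≈𝟘⇒A≈𝟘 B₁*Q≈I Q*A≈𝟘) ≈ᴹ.refl ≈ᴹ.refl (Q*A≈𝟘⇒A≈𝟘 B₂*P≈I P*D≈𝟘))
    where
    A B₁ B₂ D : Mat k
    A  = topLeft {k} C
    B₁ = topRight {k} C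
    B₂ = bottomLeft {k} C
    D  = bottomRight {k} C

module CyclotomicValues {c ℓ : Level} (R : CommutativeRing c ℓ) where
  open CommutativeRing R
  open Over R
  open import Algebra.Properties.Semiring.Exp semiring using (_^_; ^-congˡ; ^-assocʳ)
  open import Algebra.Properties.Ring ring using ([y-z]x≈yx-zx)
  open import Algebra.Properties.Group +-group using (x∙y⁻¹≈ε⇒x≈y; x≈y⇒x∙y⁻¹≈ε)
  open import Relation.Binary.Reasoning.Setoid setoid

  ^ᴿ≡^ : ∀ x n → x ^ᴿ n ≡ x ^ n
  ^ᴿ≡^ x zero    = ≡.refl
  ^ᴿ≡^ x (suc n) = ≡.cong (x *_) (^ᴿ≡^ x n)

  ^ᴿ-congˡ : ∀ n {x y} → x ≈ y → x ^ᴿ n ≈ y ^ᴿ n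
  ^ᴿ-congˡ n {x} {y} x≈y = begin
    x ^ᴿ n ≡⟨ ^ᴿ≡^ x n ⟩
    x ^ n  ≈⟨ ^-congˡ n x≈y ⟩
    y ^ n  ≡⟨ ^ᴿ≡^ y n ⟨
    y ^ᴿ n ∎

  ^ᴿ-*ʳ : ∀ x i q → x ^ᴿ (i ℕ.* q) ≈ (x ^ᴿ q) ^ᴿ i
  ^ᴿ-*ʳ x i q = begin
    x ^ᴿ (i ℕ.* q) ≡⟨ ^ᴿ≡^ x (i ℕ.* q) ⟩
    x ^ (i ℕ.* q)  ≡⟨ ≡.cong (x ^_) (ℕₚ.*-comm i q) ⟩
    x ^ (q ℕ.* i)  ≈⟨ ^-assocʳ x q i ⟨
    (x ^ q) ^ i    ≡⟨ ≡.cong (_^ i) (^ᴿ≡^ x q) ⟨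
    (x ^ᴿ q) ^ i   ≡⟨ ^ᴿ≡^ (x ^ᴿ q) i ⟨
    (x ^ᴿ q) ^ᴿ i  ∎

  1^ᴿ : ∀ n → 1# ^ᴿ n ≈ 1#
  1^ᴿ zero    = refl
  1^ᴿ (suc n) = trans (*-identityˡ _) (1^ᴿ n)

  Σℕ-cong : ∀ n {f g : ℕ → Carrier} → (∀ i → f i ≈ g i) → Σℕ n f ≈ Σℕ n g
  Σℕ-cong zero    f≈g = refl
  Σℕ-cong (suc n) f≈g = +-cong (Σℕ-cong n f≈g) (f≈g n)

  x-y+[z-x]≈z-y : ∀ x y z → (x - y) + (z - x) ≈ z - y
  x-y+[z-x]≈z-y x y z = begin
    (x - y) + (z - x)   ≈⟨ +-comm _ _ ⟩
    (z - x) + (x - y)   ≈⟨ +-assoc z (- x) (x - y) ⟩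
    z + (- x + (x - y)) ≈⟨ +-congˡ (+-assoc (- x) x (- y)) ⟨
    z + ((- x + x) - y) ≈⟨ +-congˡ (+-congʳ (-‿inverseˡ x)) ⟩
    z + (0# - y)        ≈⟨ +-congˡ (+-identityˡ (- y)) ⟩
    z - y               ∎

  geometric-sum : ∀ y m → (y - 1#) * Σℕ m (y ^ᴿ_) ≈ y ^ᴿ m - 1#
  geometric-sum y zero    = trans (zeroʳ _) (sym (-‿inverseʳ 1#))
  geometric-sum y (suc m) = begin
    (y - 1#) * (Σℕ m (y ^ᴿ_) + y ^ᴿ m)               ≈⟨ distribˡ _ _ _ ⟩
    (y - 1#) * Σℕ m (y ^ᴿ_) + (y - 1#) * y ^ᴿ m       ≈⟨ +-cong (geometric-sum y m) ([y-z]x≈yx-zx (y ^ᴿ m) y 1#) ⟩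
    (y ^ᴿ m - 1#) + (y ^ᴿ suc m - 1# * y ^ᴿ m)       ≈⟨ +-congˡ (+-congˡ (-‿cong (*-identityˡ _))) ⟩
    (y ^ᴿ m - 1#) + (y ^ᴿ suc m - y ^ᴿ m)            ≈⟨ x-y+[z-x]≈z-y _ _ _ ⟩
    y ^ᴿ suc m - 1#                                  ∎

  module RootsOfUnity
    (p : ℕ) (ζ : ℕ → Carrier) (ζ₀≈1 : ζ 0 ≈ 1#) (ζ-root : ∀ n → ζ (suc n) ^ᴿ p ≈ ζ n) (ζ₁≉1 : ¬ (ζ 1 ≈ 1#))
    (inv : Carrier → Carrier) (inv-correct : ∀ x → ¬ (x ≈ 0#) → x * inv x ≈ 1#)
    where

    ε : ℕ → Carrier
    ε m = ζ m - 1#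

    ζ[t+j]^[p^t]≈ζ[j] : ∀ t j → ζ (t ℕ.+ j) ^ᴿ (p ℕ.^ t) ≈ ζ j
    ζ[t+j]^[p^t]≈ζ[j] zero    j = *-identityʳ (ζ j)
    ζ[t+j]^[p^t]≈ζ[j] (suc t) j = begin
      ζ (suc (t ℕ.+ j)) ^ᴿ (p ℕ.* p ℕ.^ t)    ≡⟨ ≡.cong (ζ (suc (t ℕ.+ j)) ^ᴿ_) (ℕₚ.*-comm p (p ℕ.^ t)) ⟩
      ζ (suc (t ℕ.+ j)) ^ᴿ (p ℕ.^ t ℕ.* p)    ≈⟨ ^ᴿ-*ʳ _ (p ℕ.^ t) p ⟩
      (ζ (suc (t ℕ.+ j)) ^ᴿ p) ^ᴿ (p ℕ.^ t)   ≈⟨ ^ᴿ-congˡ (p ℕ.^ t) (ζ-root (t ℕ.+ j)) ⟩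
      ζ (t ℕ.+ j) ^ᴿ (p ℕ.^ t)                ≈⟨ ζ[t+j]^[p^t]≈ζ[j] t j ⟩
      ζ j                                     ∎

    ε[1+j]≉0 : ∀ j → ¬ (ε (suc j) ≈ 0#)
    ε[1+j]≉0 j ε≈0 = ζ₁≉1 (begin
      ζ 1                         ≈⟨ ζ[t+j]^[p^t]≈ζ[j] j 1 ⟨
      ζ (j ℕ.+ 1) ^ᴿ (p ℕ.^ j)    ≡⟨ ≡.cong (λ m → ζ m ^ᴿ (p ℕ.^ j)) (ℕₚ.+-comm j 1) ⟩
      ζ (suc j) ^ᴿ (p ℕ.^ j)      ≈⟨ ^ᴿ-congˡ (p ℕ.^ j) (x∙y⁻¹≈ε⇒x≈y _ _ ε≈0) ⟩
      1# ^ᴿ (p ℕ.^ j)             ≈⟨ 1^ᴿ (p ℕ.^ j) ⟩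
      1#                          ∎)

    x*y≈z⇒y≈z*inv[x] : ∀ {x y z} → ¬ (x ≈ 0#) → x * y ≈ z → y ≈ z * inv x
    x*y≈z⇒y≈z*inv[x] {x} {y} {z} x≉0 x*y≈z = begin
      y                 ≈⟨ *-identityʳ y ⟨
      y * 1#            ≈⟨ *-congˡ (inv-correct x x≉0) ⟨
      y * (x * inv x)   ≈⟨ *-assoc y x (inv x) ⟨
      (y * x) * inv x   ≈⟨ *-congʳ (trans (*-comm y x) x*y≈z) ⟩
      z * inv x         ∎

    ε*Φ≈ε : ∀ r s → ε (suc s) * Φ p (suc r) (ζ (r ℕ.+ suc s)) ≈ ε s
    ε*Φ≈ε r s = begin
      ε (suc s) * Σℕ p (λ i → ζ (r ℕ.+ suc s) ^ᴿ (i ℕ.* p ℕ.^ r)) ≈⟨ *-congˡ (Σℕ-cong p powers) ⟩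
      ε (suc s) * Σℕ p (ζ (suc s) ^ᴿ_)                             ≈⟨ geometric-sum (ζ (suc s)) p ⟩
      ζ (suc s) ^ᴿ p - 1#                                          ≈⟨ +-congʳ (ζ-root s) ⟩
      ε s                                                          ∎
      where
      powers : ∀ i → ζ (r ℕ.+ suc s) ^ᴿ (i ℕ.* p ℕ.^ r) ≈ ζ (suc s) ^ᴿ i
      powers i = trans (^ᴿ-*ʳ _ i (p ℕ.^ r)) (^ᴿ-congˡ i (ζ[t+j]^[p^t]≈ζ[j] r (suc s)))

    Φ-at-root : ∀ r s → Φ p (suc r) (ζ (r ℕ.+ suc s)) ≈ ε s * inv (ε (suc s))
    Φ-at-root r s = x*y≈z⇒y≈z*inv[x] (ε[1+j]≉0 s) (ε*Φ≈ε r s)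

    Φ-at-own-root : ∀ r → Φ p (suc r) (ζ (r ℕ.+ 1)) ≈ 0#
    Φ-at-own-root r = trans (Φ-at-root r 0) (trans (*-congʳ (x≈y⇒x∙y⁻¹≈ε ζ₀≈1)) (zeroˡ _))

module Products {c ℓ : Level} (R : CommutativeRing c ℓ) where
  open CommutativeRing R
  open Over R
  open MatrixAlgebra R
  open CyclotomicValues R

  module Peeling
    (p : ℕ) (ζ : ℕ → Carrier) (ζ₀≈1 : ζ 0 ≈ 1#) (ζ-root : ∀ n → ζ (suc n) ^ᴿ p ≈ ζ n) (ζ₁≉1 : ¬ (ζ 1 ≈ 1#))
    (inv : Carrier → Carrier) (inv-correct : ∀ x → ¬ (x ≈ 0#) → x * inv x ≈ 1#)
    {k : ℕ} (P Q : Mat k) (C⁻¹ : Mat (k ℕ.+ k))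
    (N*C⁻¹≈I : (block 𝟘ᴹ P Q 𝟘ᴹ *ᴹ C⁻¹) ≈ᴹ Iᴹ) (C⁻¹*N≈I : (C⁻¹ *ᴹ block 𝟘ᴹ P Q 𝟘ᴹ) ≈ᴹ Iᴹ)
    where

    open RootsOfUnity p ζ ζ₀≈1 ζ-root ζ₁≉1 inv inv-correct
    open import Relation.Binary.Reasoning.Setoid (≈ᴹ-setoid (k ℕ.+ k))

    B₁ B₂ M : Mat k
    B₁ = topRight {k} C⁻¹
    B₂ = bottomLeft {k} C⁻¹
    M  = B₁ *ᴹ B₂

    C H : ℕ → Carrier → Mat (k ℕ.+ k)
    C m z = Cev p {k} C⁻¹ m z
    H n z = Hev p {k} C⁻¹ n z

    C-antidiagonal : ∀ m z → C m z ≈ᴹ block 𝟘ᴹ B₁ (Φ p m z •ᴹ B₂) 𝟘ᴹ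
    C-antidiagonal m z = begin
      block {k} Iᴹ 𝟘ᴹ 𝟘ᴹ (φ •ᴹ Iᴹ) *ᴹ C⁻¹
        ≈⟨ *ᴹ-cong ≈ᴹ.refl (antidiagonal-inverse {k} N*C⁻¹≈I C⁻¹*N≈I) ⟩
      block {k} Iᴹ 𝟘ᴹ 𝟘ᴹ (φ •ᴹ Iᴹ) *ᴹ block 𝟘ᴹ B₁ B₂ 𝟘ᴹ
        ≈⟨ *ᴹ-antidiagonal Iᴹ 𝟘ᴹ 𝟘ᴹ (φ •ᴹ Iᴹ) B₁ B₂ ⟩
      block (𝟘ᴹ *ᴹ B₂) (Iᴹ *ᴹ B₁) ((φ •ᴹ Iᴹ) *ᴹ B₂) (𝟘ᴹ *ᴹ B₁)
        ≈⟨ block-cong (*ᴹ-zeroˡ B₂) (*ᴹ-identityˡ B₁)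
             (≈ᴹ.trans (•ᴹ-*ᴹ φ Iᴹ B₂) (•ᴹ-cong refl (*ᴹ-identityˡ B₂))) (*ᴹ-zeroˡ B₁) ⟩
      block 𝟘ᴹ B₁ (φ •ᴹ B₂) 𝟘ᴹ
        ∎
      where
      φ : Carrier
      φ = Φ p m z

    oddForm evenForm : ℕ → Mat (k ℕ.+ k)
    oddForm  t = block 𝟘ᴹ (δpairs ε inv t •ᴹ ((M ^ᴹ t) *ᴹ B₁)) 𝟘ᴹ 𝟘ᴹ
    evenForm t = block (δpairs ε inv t •ᴹ (M ^ᴹ t)) 𝟘ᴹ 𝟘ᴹ 𝟘ᴹ

    C-at-own-root : ∀ r → C (suc r) (ζ (r ℕ.+ 1)) ≈ᴹ oddForm 0
    C-at-own-root r = ≈ᴹ.trans (C-antidiagonal (suc r) (ζ (r ℕ.+ 1))) (block-cong ≈ᴹ.refl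
      (λ a b → sym (trans (*-identityˡ _) (*ᴹ-identityˡ B₁ a b)))
      (λ a b → trans (*-congʳ (Φ-at-own-root r)) (zeroˡ _))
      ≈ᴹ.refl)

    evenForm*C≈oddForm : ∀ t m z → (evenForm t *ᴹ C m z) ≈ᴹ oddForm t
    evenForm*C≈oddForm t m z = begin
      evenForm t *ᴹ C m z
        ≈⟨ *ᴹ-cong ≈ᴹ.refl (C-antidiagonal m z) ⟩
      block (d •ᴹ (M ^ᴹ t)) 𝟘ᴹ 𝟘ᴹ 𝟘ᴹ *ᴹ block 𝟘ᴹ B₁ (φ •ᴹ B₂) 𝟘ᴹ
        ≈⟨ *ᴹ-antidiagonal {k} _ _ _ _ _ _ ⟩
      block (𝟘ᴹ *ᴹ (φ •ᴹ B₂)) ((d •ᴹ (M ^ᴹ t)) *ᴹ B₁) (𝟘ᴹ *ᴹ (φ •ᴹ B₂)) (𝟘ᴹ *ᴹ B₁)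
        ≈⟨ block-cong (*ᴹ-zeroˡ _) (•ᴹ-*ᴹ d (M ^ᴹ t) B₁) (*ᴹ-zeroˡ _) (*ᴹ-zeroˡ B₁) ⟩
      oddForm t
        ∎
      where
      d φ : Carrier
      d = δpairs ε inv t
      φ = Φ p m z

    oddForm*C≈evenForm : ∀ t m z → Φ p m z ≈ ε (suc (2 ℕ.* t)) * inv (ε (suc (suc (2 ℕ.* t)))) →
                         (oddForm t *ᴹ C m z) ≈ᴹ evenForm (suc t)
    oddForm*C≈evenForm t m z φ≈ = begin
      oddForm t *ᴹ C m z
        ≈⟨ *ᴹ-cong ≈ᴹ.refl (C-antidiagonal m z) ⟩
      block 𝟘ᴹ (d •ᴹ ((M ^ᴹ t) *ᴹ B₁)) 𝟘ᴹ 𝟘ᴹ *ᴹ block 𝟘ᴹ B₁ (φ •ᴹ B₂) 𝟘ᴹ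
        ≈⟨ *ᴹ-antidiagonal {k} _ _ _ _ _ _ ⟩
      block ((d •ᴹ ((M ^ᴹ t) *ᴹ B₁)) *ᴹ (φ •ᴹ B₂)) (𝟘ᴹ *ᴹ B₁) (𝟘ᴹ *ᴹ (φ •ᴹ B₂)) (𝟘ᴹ *ᴹ B₁)
        ≈⟨ block-cong topLeft≈ (*ᴹ-zeroˡ B₁) (*ᴹ-zeroˡ _) (*ᴹ-zeroˡ B₁) ⟩
      evenForm (suc t)
        ∎
      where
      d φ : Carrier
      d = δpairs ε inv t
      φ = Φ p m z
      topLeft≈ : ((d •ᴹ ((M ^ᴹ t) *ᴹ B₁)) *ᴹ (φ •ᴹ B₂)) ≈ᴹ (δpairs ε inv (suc t) •ᴹ (M ^ᴹ suc t))
      topLeft≈ = ≈ᴹ.trans (•ᴹ-*ᴹ-•ᴹ d φ _ B₂)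
        (•ᴹ-cong (*-congˡ φ≈) (≈ᴹ.trans (*ᴹ-assoc (M ^ᴹ t) B₁ B₂) (^ᴹ-sucʳ M t)))

    peel-odd  : ∀ t r n → n ≡ r ℕ.+ suc (2 ℕ.* t) → H n (ζ n) ≈ᴹ (oddForm t *ᴹ H r (ζ n))
    peel-even : ∀ t r n → n ≡ r ℕ.+ suc (suc (2 ℕ.* t)) → H n (ζ n) ≈ᴹ (evenForm (suc t) *ᴹ H r (ζ n))

    peel-odd zero r .(r ℕ.+ 1) ≡.refl = begin
      H (r ℕ.+ 1) z         ≡⟨ ≡.cong (λ m → H m z) (ℕₚ.+-comm r 1) ⟩
      C (suc r) z *ᴹ H r z  ≈⟨ *ᴹ-cong (C-at-own-root r) ≈ᴹ.refl ⟩
      oddForm 0 *ᴹ H r z    ∎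
      where
      z : Carrier
      z = ζ (r ℕ.+ 1)
    peel-odd (suc t) r n n≡ = begin
      H n z                                          ≈⟨ peel-even t (suc r) n n≡′ ⟩
      evenForm (suc t) *ᴹ (C (suc r) z *ᴹ H r z)     ≈⟨ *ᴹ-assoc _ _ _ ⟨
      (evenForm (suc t) *ᴹ C (suc r) z) *ᴹ H r z     ≈⟨ *ᴹ-cong (evenForm*C≈oddForm (suc t) (suc r) z) ≈ᴹ.refl ⟩
      oddForm (suc t) *ᴹ H r z                       ∎
      where
      z : Carrier
      z = ζ n
      n≡′ : n ≡ suc r ℕ.+ suc (suc (2 ℕ.* t))
      n≡′ = ≡.trans n≡ (≡.trans (≡.cong (λ m → r ℕ.+ suc m) (ℕₚ.*-suc 2 t)) (ℕₚ.+-suc r _))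

    peel-even t r .(r ℕ.+ suc (suc (2 ℕ.* t))) ≡.refl = begin
      H n z                                  ≈⟨ peel-odd t (suc r) n (ℕₚ.+-suc r _) ⟩
      oddForm t *ᴹ (C (suc r) z *ᴹ H r z)    ≈⟨ *ᴹ-assoc _ _ _ ⟨
      (oddForm t *ᴹ C (suc r) z) *ᴹ H r z    ≈⟨ *ᴹ-cong (oddForm*C≈evenForm t (suc r) z (Φ-at-root r (suc (2 ℕ.* t)))) ≈ᴹ.refl ⟩
      evenForm (suc t) *ᴹ H r z              ∎
      where
      n : ℕ
      n = r ℕ.+ suc (suc (2 ℕ.* t))
      z : Carrier
      z = ζ n

    H-odd : ∀ n → n % 2 ≡ 1 → H n (ζ n) ≈ᴹ block 𝟘ᴹ (δ ε inv n •ᴹ ((M ^ᴹ ((n ∸ 1) / 2)) *ᴹ B₁)) 𝟘ᴹ 𝟘ᴹ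
    H-odd n n%2≡1 = begin
      H n (ζ n)               ≈⟨ peel-odd (n / 2) 0 n (n%2≡1⇒n≡1+2*[n/2] n n%2≡1) ⟩
      oddForm (n / 2) *ᴹ Iᴹ   ≈⟨ *ᴹ-identityʳ _ ⟩
      oddForm (n / 2)         ≡⟨ ≡.cong (λ e → block 𝟘ᴹ (δ ε inv n •ᴹ ((M ^ᴹ e) *ᴹ B₁)) 𝟘ᴹ 𝟘ᴹ)
                                   (n%2≡1⇒[n∸1]/2≡n/2 n n%2≡1) ⟨
      block 𝟘ᴹ (δ ε inv n •ᴹ ((M ^ᴹ ((n ∸ 1) / 2)) *ᴹ B₁)) 𝟘ᴹ 𝟘ᴹ ∎

    H-even : ∀ n → 1 ≤ n → n % 2 ≡ 0 → H n (ζ n) ≈ᴹ block (δ ε inv n •ᴹ (M ^ᴹ (n / 2))) 𝟘ᴹ 𝟘ᴹ 𝟘ᴹ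
    H-even n 1≤n n%2≡0 = H-even-form (n / 2) (n%2≡0⇒n≡2*[n/2] n n%2≡0)
      where
      H-even-form : ∀ u → n ≡ 2 ℕ.* u → H n (ζ n) ≈ᴹ evenForm u
      H-even-form zero    n≡0 = contradiction n≡0 (ℕₚ.n>0⇒n≢0 1≤n)
      H-even-form (suc t) n≡  = ≈ᴹ.trans (peel-even t 0 n (≡.trans n≡ (ℕₚ.*-suc 2 t))) (*ᴹ-identityʳ _)

lemma3p5 : ∀ {c ℓ : Level} (p : ℕ) → Prime p → p ≢ 2 →
  (R : CommutativeRing c ℓ) →
  let open CommutativeRing R
      open Over R
  in (inv : Carrier → Carrier) →
     ¬ (1# ≈ 0#) →
     (∀ x → ¬ (x ≈ 0#) → x * inv x ≈ 1#) →
     (ζ : ℕ → Carrier) →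
     ζ 0 ≈ 1# →
     (∀ n → (ζ (suc n)) ^ᴿ p ≈ ζ n) →
     ¬ (ζ 1 ≈ 1#) →
     (k : ℕ) (P Q : Mat k) (Cinv : Mat (k Data.Nat.+ k)) →
     (block {k} 𝟘ᴹ P Q 𝟘ᴹ *ᴹ Cinv) ≈ᴹ Iᴹ →
     (Cinv *ᴹ block {k} 𝟘ᴹ P Q 𝟘ᴹ) ≈ᴹ Iᴹ →
     let B₁ = topRight {k} Cinv
         B₂ = bottomLeft {k} Cinv
         ε = λ (m : ℕ) → ζ m - 1#
     in ∀ (n : ℕ) → 1 ≤ n →
        (n % 2 ≡ 1 →
          Hev p {k} Cinv n (ζ n)
            ≈ᴹ block {k} 𝟘ᴹ (δ ε inv n •ᴹ (((B₁ *ᴹ B₂) ^ᴹ ((n ∸ 1) / 2)) *ᴹ B₁)) 𝟘ᴹ 𝟘ᴹ)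
        ×
        (n % 2 ≡ 0 →
          Hev p {k} Cinv n (ζ n)
            ≈ᴹ block {k} (δ ε inv n •ᴹ ((B₁ *ᴹ B₂) ^ᴹ (n / 2))) 𝟘ᴹ 𝟘ᴹ 𝟘ᴹ)
lemma3p5 p _ _ R inv _ inv-correct ζ ζ₀≈1 ζ-root ζ₁≉1 k P Q C⁻¹ N*C⁻¹≈I C⁻¹*N≈I n 1≤n =
  H-odd n , H-even n 1≤n
  where
  open Products.Peeling R p ζ ζ₀≈1 ζ-root ζ₁≉1 inv inv-correct P Q C⁻¹ N*C⁻¹≈I C⁻¹*N≈I
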